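{- Let $S$ be a restriction semigroup, let $\mathsf e,\mathsf f\in D(S)$ and $s,t\in S$ satisfy $\mathsf e st=\mathsf e t$ and $\mathsf f t=\mathsf f$. Then $(\mathsf e s)^n\mathsf f\le t$ for all $n\ge 0$ (where $(\mathsf e s)^0\mathsf f$ means $\mathsf f$).
   Context: A restriction semigroup is a semigroup $S$ with a unary operation $D$ satisfying, for all $s,t\in S$: $D(s)s=s$, $D(st)=D(s)D(st)$, $D(s)D(t)=D(t)D(s)$, $D(D(s))=D(s)$, $sD(t)=D(st)s$. $D(S)=\{D(s)\mid s\in S\}$. The natural order on $S$ is $s\le t$ iff $s=D(s)t$. -}

module Defs where

open import Level using (Level; _⊔_; suc)
open import Data.Nat using (ℕ; zero; suc)
open import Data.Product using (∃; _×_)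
open import Algebra.Bundles using (Semigroup)
open import Relation.Binary.PropositionalEquality using (_≡_)

record RestrictionSemigroup (c ℓ : Level) : Set (Level.suc (c ⊔ ℓ)) where
  field
    semigroup : Semigroup c ℓ
  open Semigroup semigroup public
  field
    D       : Carrier → Carrier
    D-cong  : ∀ {x y} → x ≈ y → D x ≈ D y
    D-left  : ∀ s → D s ∙ s ≈ s
    D-mul   : ∀ s t → D (s ∙ t) ≈ D s ∙ D (s ∙ t)
    D-comm  : ∀ s t → D s ∙ D t ≈ D t ∙ D s
    D-idem  : ∀ s → D (D s) ≈ D s
    D-ample : ∀ s t → s ∙ D t ≈ D (s ∙ t) ∙ s

  InD : Carrier → Set (c ⊔ ℓ)
  InD e = ∃ λ x → e ≈ D x

  _≤_ : Carrier → Carrier → Set ℓ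
  s ≤ t = s ≈ D s ∙ t

  powTimes : Carrier → ℕ → Carrier → Carrier
  powTimes a zero    f = f
  powTimes a (suc n) f = a ∙ powTimes a n f

module Submission where

open import Defs
open import Level using (Level)
open import Data.Nat using (ℕ; zero; suc)
open import Data.Product using (_,_)
import Relation.Binary.Reasoning.Setoid as SetoidReasoning

-- Left multiplication is monotone for the natural order, so
-- (es)ⁿ f ≤ t gives (es)ⁿ⁺¹ f ≤ est = et; and an element of the form e u lying
-- below e t already lies below t, because its domain is absorbed by e.

module RestrictionProperties {c ℓ : Level} (S : RestrictionSemigroup c ℓ) where

  open RestrictionSemigroup S
  open SetoidReasoning setoid

  InD⇒D-fixed : ∀ {e} → InD e → D e ≈ e
  InD⇒D-fixed {e} (x , e≈Dx) = trans (D-cong e≈Dx) (trans (D-idem x) (sym e≈Dx))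

  D-∙-absorbʳ-D : ∀ x u → D (x ∙ u) ∙ D x ≈ D (x ∙ u)
  D-∙-absorbʳ-D x u = trans (D-comm (x ∙ u) x) (sym (D-mul x u))

  ≤-respˡ-≈ : ∀ {x y t} → x ≈ y → x ≤ t → y ≤ t
  ≤-respˡ-≈ {x} {y} {t} x≈y x≤t = begin
    y         ≈⟨ sym x≈y ⟩
    x         ≈⟨ x≤t ⟩
    D x ∙ t   ≈⟨ ∙-cong (D-cong x≈y) refl ⟩
    D y ∙ t   ∎

  ≤-respʳ-≈ : ∀ {x t u} → t ≈ u → x ≤ t → x ≤ u
  ≤-respʳ-≈ t≈u x≤t = trans x≤t (∙-cong refl t≈u)

  ≤-intro-fixed : ∀ {f t} → D f ≈ f → f ∙ t ≈ f → f ≤ t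
  ≤-intro-fixed {f} {t} Df≈f ft≈f = begin
    f         ≈⟨ sym ft≈f ⟩
    f ∙ t     ≈⟨ ∙-cong (sym Df≈f) refl ⟩
    D f ∙ t   ∎

  ∙-monoʳ-≤ : ∀ a {p t} → p ≤ t → (a ∙ p) ≤ (a ∙ t)
  ∙-monoʳ-≤ a {p} {t} p≤t = begin
    a ∙ p               ≈⟨ ∙-cong refl p≤t ⟩
    a ∙ (D p ∙ t)       ≈⟨ sym (assoc a (D p) t) ⟩
    (a ∙ D p) ∙ t       ≈⟨ ∙-cong (D-ample a p) refl ⟩
    (D (a ∙ p) ∙ a) ∙ t ≈⟨ assoc (D (a ∙ p)) a t ⟩
    D (a ∙ p) ∙ (a ∙ t) ∎

  ≤-cancelˡ-fixed : ∀ {e u t} → D e ≈ e → (e ∙ u) ≤ (e ∙ t) → (e ∙ u) ≤ t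
  ≤-cancelˡ-fixed {e} {u} {t} De≈e eu≤et = begin
    e ∙ u                 ≈⟨ eu≤et ⟩
    D (e ∙ u) ∙ (e ∙ t)   ≈⟨ sym (assoc (D (e ∙ u)) e t) ⟩
    (D (e ∙ u) ∙ e) ∙ t   ≈⟨ ∙-cong (∙-cong refl (sym De≈e)) refl ⟩
    (D (e ∙ u) ∙ D e) ∙ t ≈⟨ ∙-cong (D-∙-absorbʳ-D e u) refl ⟩
    D (e ∙ u) ∙ t         ∎

lemma4p1 : ∀ {c ℓ : Level} (S : RestrictionSemigroup c ℓ) →
    let open RestrictionSemigroup S in
    ∀ (e f s t : Carrier) → InD e → InD f →
    e ∙ s ∙ t ≈ e ∙ t → f ∙ t ≈ f →
    ∀ (n : ℕ) → powTimes (e ∙ s) n f ≤ t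
lemma4p1 S e f s t e∈D f∈D est≈et ft≈f = below
  where
  open RestrictionSemigroup S
  open RestrictionProperties S

  below : ∀ n → powTimes (e ∙ s) n f ≤ t
  below zero    = ≤-intro-fixed (InD⇒D-fixed f∈D) ft≈f
  below (suc n) =
    ≤-respˡ-≈ (sym (assoc e s p))
      (≤-cancelˡ-fixed (InD⇒D-fixed e∈D)
        (≤-respʳ-≈ est≈et
          (≤-respˡ-≈ (assoc e s p) (∙-monoʳ-≤ (e ∙ s) (below n)))))
    where p = powTimes (e ∙ s) n f
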